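{- Let $\Gamma$ be a finite undirected multigraph (self-loops and parallel edges allowed) with vertex set $V$, and fix a vertex $v\in V$. Assume that $V\setminus\{v\}\neq\varnothing$. Then \[ \sum_{\substack{F\subseteq V\setminus\{v\}\text{ is vertex-pandemic}}}(-1)^{|F|}=0 . \]
   Context: For $F\subseteq V$, an $F$-vertex-path is a path of $\Gamma$ such that all vertices of the path except possibly its two endpoints belong to $F$ (so any path with at most one edge is an $F$-vertex-path). For $w\in V\setminus\{v\}$ and $F\subseteq V\setminus\{v\}$, $F$ vertex-infects $w$ if there exists an $F$-vertex-path from $v$ to $w$. A subset $F\subseteq V\setminus\{v\}$ is vertex-pandemic if it vertex-infects every vertex $w\in V\setminus\{v\}$. -}

module Defs where

open import Data.Nat using (ℕ; zero; suc)
open import Data.Fin using (Fin)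
open import Data.Fin.Subset using (Subset; _∈_; _∉_; ∣_∣; inside; outside)
open import Data.Bool using (Bool)
open import Data.Vec using (_∷_; [])
open import Data.List using (List; []; _∷_; _∷ʳ_; map; filter; foldr; _++_)
open import Data.List.Relation.Unary.All using (All)
open import Data.List.Relation.Unary.Linked using (Linked)
open import Data.List.Relation.Unary.Unique.Propositional using (Unique)
open import Data.Product using (Σ; ∃; _×_; _,_)
open import Data.Sum using (_⊎_)
open import Data.Integer using (ℤ; _+_; _^_; -1ℤ; 0ℤ)
open import Relation.Binary.PropositionalEquality using (_≡_; _≢_)
open import Relation.Nullary using (Dec)
open import Relation.Unary using (Decidable)

-- A finite undirected multigraph on vertex set Fin n: a finite set of
-- edges Fin m, each with an (unordered) pair of endpoints.  Self-loops
-- (ends e = (x , x)) and parallel edges (ends e = ends e') are allowed.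
record Multigraph (n : ℕ) : Set where
  field
    m    : ℕ
    ends : Fin m → Fin n × Fin n

open Multigraph public

Adj : ∀ {n} → Multigraph n → Fin n → Fin n → Set
Adj Γ x y = ∃ λ e → (ends Γ e ≡ (x , y)) ⊎ (ends Γ e ≡ (y , x))

IsPath : ∀ {n} → Multigraph n → Fin n → List (Fin n) → Fin n → Set
IsPath Γ x mid y = Unique (x ∷ (mid ∷ʳ y)) × Linked (Adj Γ) (x ∷ (mid ∷ʳ y))

FVertexPath : ∀ {n} → Multigraph n → Subset n → Fin n → Fin n → Set
FVertexPath Γ F x y = Σ (List _) λ mid → IsPath Γ x mid y × All (_∈ F) mid

VertexInfects : ∀ {n} → Multigraph n → Fin n → Subset n → Fin n → Set
VertexInfects Γ v F w = FVertexPath Γ F v w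

VertexPandemic : ∀ {n} → Multigraph n → Fin n → Subset n → Set
VertexPandemic Γ v F = ∀ w → w ≢ v → VertexInfects Γ v F w

PandemicSubset : ∀ {n} → Multigraph n → Fin n → Subset n → Set
PandemicSubset Γ v F = (v ∉ F) × VertexPandemic Γ v F

allSubsets : (n : ℕ) → List (Subset n)
allSubsets zero    = [] ∷ []
allSubsets (suc n) = map (inside ∷_) (allSubsets n) ++ map (outside ∷_) (allSubsets n)

sumℤ : List ℤ → ℤ
sumℤ = foldr _+_ 0ℤ

-- Σ_{F ⊆ V∖{v} vertex-pandemic} (-1)^|F|, computed with any decision
-- procedure for the predicate (the value does not depend on the choice).
pandemicSignSum : ∀ {n} (Γ : Multigraph n) (v : Fin n) →
                  Decidable (PandemicSubset Γ v) → ℤ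
pandemicSignSum {n} Γ v dec =
  sumℤ (map (λ F → -1ℤ ^ ∣ F ∣) (filter dec (allSubsets n)))

{-# OPTIONS --safe #-}
module Submission where

-- Build F one vertex at a time.  Suppose a part T of F is fixed and T already
-- infects every vertex outside a list L of still undecided vertices.  If T
-- infects some u ∈ L, split the sum over F according to whether u ∈ F: both
-- halves are again of this form (u stays infected whatever is added), and when
-- L = [u] they are the two pandemic sets T and T ∪ {u}, of opposite sign.  If T
-- infects no vertex of L, no F with T ⊆ F ⊆ T ∪ L is pandemic: a path from v to
-- a vertex of L with interior in T ∪ L first meets L at a vertex infected by T.
-- Starting from T = ∅ and L = V ∖ {v} gives the theorem.

open import Defs
open import Algebra.Bundles using (CommutativeMonoid)
import Algebra.Properties.CommutativeSemigroup as CommSemigroupProperties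
open import Data.Bool using (Bool)
open import Data.Bool.Properties using (∨-identityʳ)
open import Data.Empty using (⊥-elim)
open import Data.Fin using (Fin; zero; suc; _≟_)
open import Data.Fin.Subset
  using (Subset; inside; outside; ∣_∣; _∪_; ⁅_⁆; _⊆_)
  renaming (_∈_ to _∈ₛ_; _∉_ to _∉ₛ_; ⊥ to ∅)
open import Data.Fin.Subset.Properties
  using (∉⊥; x∈⁅x⁆; x∈⁅y⁆⇒x≡y; x∈p∪q⁺; x∈p∪q⁻; p⊆p∪q; ∪-identityʳ; ∪-commutativeMonoid)
open import Data.Integer using (ℤ; 0ℤ; -1ℤ; _+_; _*_; _^_; -_)
import Data.Integer.Properties as ℤ
open import Data.List using (List; []; _∷_; _++_; [_]; map; filter; length; allFin)
open import Data.List.Properties using (++-assoc; ++-identityʳ; map-++; map-∘; map-tabulate)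
open import Data.List.Membership.Propositional using (_∈_; _∉_; find; lose)
open import Data.List.Membership.Propositional.Properties using (∈-∃++; ∈-allFin)
open import Data.List.Relation.Binary.Permutation.Propositional
  using (_↭_; refl; prep; swap; trans; ↭-sym; ↭⇒↭ₛ)
open import Data.List.Relation.Binary.Permutation.Propositional.Properties
  using (shift; ∈-resp-↭; ↭-length)
import Data.List.Relation.Binary.Permutation.Setoid.Properties as SetoidPermutation
open import Data.List.Relation.Unary.All using (All; []; _∷_)
import Data.List.Relation.Unary.All as All
open import Data.List.Relation.Unary.All.Properties using (++⁺; ++⁻ˡ)
open import Data.List.Relation.Unary.AllPairs using (AllPairs; []; _∷_)
open import Data.List.Relation.Unary.Any using (Any; here; there)
open import Data.List.Relation.Unary.Linked using (Linked; []; [-]; _∷_)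
open import Data.List.Relation.Unary.Unique.Propositional using (Unique)
open import Data.List.Relation.Unary.Unique.Propositional.Properties using (allFin⁺)
open import Data.Nat using (ℕ; suc)
import Data.Nat.Properties as ℕ
open import Data.Product using (∃; _×_; _,_; proj₁; proj₂)
open import Data.Sum using (_⊎_; inj₁; inj₂; map₂)
open import Data.Vec using ([]; _∷_; here; there)
open import Function using (_∘_)
open import Relation.Binary.PropositionalEquality
  using (_≡_; _≢_; refl; sym; cong; cong₂; subst; module ≡-Reasoning)
  renaming (trans to ≡-trans; setoid to ≡-setoid)
open import Relation.Nullary using (¬_; Dec; yes; no)
open import Relation.Nullary.Decidable using (decidable-stable; ¬¬-excluded-middle)
open import Relation.Unary using (Decidable)

open ≡-Reasoning

module _ {A : Set} {R : A → A → Set} where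

  AllPairs-++⁻ˡ : ∀ xs {ys} → AllPairs R (xs ++ ys) → AllPairs R xs
  AllPairs-++⁻ˡ []       _            = []
  AllPairs-++⁻ˡ (x ∷ xs) (px ∷ pxsys) = ++⁻ˡ xs px ∷ AllPairs-++⁻ˡ xs pxsys

  Linked-++⁻ˡ : ∀ xs {ys} → Linked R (xs ++ ys) → Linked R xs
  Linked-++⁻ˡ []           _           = []
  Linked-++⁻ˡ (x ∷ [])     _           = [-]
  Linked-++⁻ˡ (x ∷ y ∷ xs) (r ∷ rxsys) = r ∷ Linked-++⁻ˡ (y ∷ xs) rxsys

Unique-∷⁻ : ∀ {A : Set} {x : A} {xs} → Unique (x ∷ xs) → x ∉ xs × Unique xs
Unique-∷⁻ (x≢xs ∷ unique) = (λ x∈xs → All.lookup x≢xs x∈xs refl) , unique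

∈⇒↭ : ∀ {A : Set} {x : A} {xs} → x ∈ xs → ∃ λ ys → xs ↭ x ∷ ys
∈⇒↭ {x = x} x∈xs with ∈-∃++ x∈xs
... | ys , zs , refl = ys ++ zs , shift x ys zs

∈-allFin∖v : ∀ {n} {v : Fin n} {R w} → allFin n ↭ v ∷ R → w ≢ v → w ∈ R
∈-allFin∖v {w = w} allFin↭v∷R w≢v with ∈-resp-↭ allFin↭v∷R (∈-allFin w)
... | here  w≡v = ⊥-elim (w≢v w≡v)
... | there w∈R = w∈R

Unique-resp-↭ : ∀ {A : Set} {xs ys : List A} → xs ↭ ys → Unique xs → Unique ys
Unique-resp-↭ {A} = SetoidPermutation.Unique-resp-↭ (≡-setoid A) ∘ ↭⇒↭ₛ

sumℤ-++ : ∀ xs ys → sumℤ (xs ++ ys) ≡ sumℤ xs + sumℤ ys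
sumℤ-++ []       ys = sym (ℤ.+-identityˡ (sumℤ ys))
sumℤ-++ (x ∷ xs) ys = ≡-trans (cong (x +_) (sumℤ-++ xs ys)) (sym (ℤ.+-assoc x (sumℤ xs) (sumℤ ys)))

restrict : ∀ {A : Set} {P : A → Set} → Decidable P → (A → ℤ) → A → ℤ
restrict P? f x with P? x
... | yes _ = f x
... | no  _ = 0ℤ

sumℤ-filter : ∀ {A : Set} {P : A → Set} (P? : Decidable P) (f : A → ℤ) xs →
              sumℤ (map f (filter P? xs)) ≡ sumℤ (map (restrict P? f) xs)
sumℤ-filter P? f []       = refl
sumℤ-filter P? f (x ∷ xs) with P? x
... | yes _ = cong (f x +_) (sumℤ-filter P? f xs)
... | no  _ = ≡-trans (sumℤ-filter P? f xs) (sym (ℤ.+-identityˡ _))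

restrict-accept : ∀ {A : Set} {P : A → Set} (P? : Decidable P) f {x} → P x → restrict P? f x ≡ f x
restrict-accept P? f {x} px with P? x
... | yes _  = refl
... | no ¬px = ⊥-elim (¬px px)

restrict-reject : ∀ {A : Set} {P : A → Set} (P? : Decidable P) f {x} → ¬ P x → restrict P? f x ≡ 0ℤ
restrict-reject P? f {x} ¬px with P? x
... | yes px = ⊥-elim (¬px px)
... | no _   = refl

sign : ∀ {n} → Subset n → ℤ
sign F = -1ℤ ^ ∣ F ∣

subsetSum : ∀ {n} → (Subset n → ℤ) → List (Fin n) → Subset n → ℤ
subsetSum h []      T = h T
subsetSum h (u ∷ L) T = subsetSum h L T + subsetSum h L (T ∪ ⁅ u ⁆)

module _ {n : ℕ} (h : Subset n → ℤ) where

  open CommSemigroupProperties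
    (CommutativeMonoid.commutativeSemigroup (∪-commutativeMonoid n))
    using (xy∙z≈xz∙y)
  open CommSemigroupProperties ℤ.+-commutativeSemigroup using (interchange)

  subsetSum-resp-↭ : ∀ {L L′} → L ↭ L′ → ∀ T → subsetSum h L T ≡ subsetSum h L′ T
  subsetSum-resp-↭ refl         T = refl
  subsetSum-resp-↭ (prep x p)   T = cong₂ _+_ (subsetSum-resp-↭ p T) (subsetSum-resp-↭ p (T ∪ ⁅ x ⁆))
  subsetSum-resp-↭ (trans p q)  T = ≡-trans (subsetSum-resp-↭ p T) (subsetSum-resp-↭ q T)
  subsetSum-resp-↭ {x ∷ y ∷ L} {y ∷ x ∷ L′} (swap x y p) T = begin
    (Σ T + Σ (T ∪ ⁅ y ⁆)) + (Σ (T ∪ ⁅ x ⁆) + Σ ((T ∪ ⁅ x ⁆) ∪ ⁅ y ⁆))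
      ≡⟨ interchange (Σ T) _ _ _ ⟩
    (Σ T + Σ (T ∪ ⁅ x ⁆)) + (Σ (T ∪ ⁅ y ⁆) + Σ ((T ∪ ⁅ x ⁆) ∪ ⁅ y ⁆))
      ≡⟨ cong (λ S → (Σ T + Σ (T ∪ ⁅ x ⁆)) + (Σ (T ∪ ⁅ y ⁆) + Σ S)) (xy∙z≈xz∙y T ⁅ x ⁆ ⁅ y ⁆) ⟩
    (Σ T + Σ (T ∪ ⁅ x ⁆)) + (Σ (T ∪ ⁅ y ⁆) + Σ ((T ∪ ⁅ y ⁆) ∪ ⁅ x ⁆))
      ≡⟨ cong₂ _+_ (cong₂ _+_ (Σ≡Σ′ T) (Σ≡Σ′ _)) (cong₂ _+_ (Σ≡Σ′ _) (Σ≡Σ′ _)) ⟩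
    (Σ′ T + Σ′ (T ∪ ⁅ x ⁆)) + (Σ′ (T ∪ ⁅ y ⁆) + Σ′ ((T ∪ ⁅ y ⁆) ∪ ⁅ x ⁆)) ∎
    where
    Σ Σ′ : Subset n → ℤ
    Σ  = subsetSum h L
    Σ′ = subsetSum h L′
    Σ≡Σ′ : ∀ S → Σ S ≡ Σ′ S
    Σ≡Σ′ = subsetSum-resp-↭ p

  subsetSum-vanishing : ∀ L T →
    (∀ S → T ⊆ S → (∀ {z} → z ∈ₛ S → z ∈ₛ T ⊎ z ∈ L) → h S ≡ 0ℤ) →
    subsetSum h L T ≡ 0ℤ
  subsetSum-vanishing []      T h≡0 = h≡0 T (λ z∈T → z∈T) inj₁
  subsetSum-vanishing (u ∷ L) T h≡0 = begin
    subsetSum h L T + subsetSum h L (T ∪ ⁅ u ⁆)  ≡⟨ cong₂ _+_ without-u with-u ⟩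
    0ℤ + 0ℤ                                     ≡⟨⟩
    0ℤ                                          ∎
    where
    without-u : subsetSum h L T ≡ 0ℤ
    without-u = subsetSum-vanishing L T λ S T⊆S S⊆ →
      h≡0 S T⊆S λ z∈S → map₂ there (S⊆ z∈S)
    move-u-into-L : ∀ {z} → z ∈ₛ T ∪ ⁅ u ⁆ ⊎ z ∈ L → z ∈ₛ T ⊎ z ∈ u ∷ L
    move-u-into-L (inj₂ z∈L)     = inj₂ (there z∈L)
    move-u-into-L (inj₁ z∈T∪⁅u⁆) with x∈p∪q⁻ T ⁅ u ⁆ z∈T∪⁅u⁆
    ... | inj₁ z∈T   = inj₁ z∈T
    ... | inj₂ z∈⁅u⁆ = inj₂ (here (x∈⁅y⁆⇒x≡y u z∈⁅u⁆))
    with-u : subsetSum h L (T ∪ ⁅ u ⁆) ≡ 0ℤ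
    with-u = subsetSum-vanishing L (T ∪ ⁅ u ⁆) λ S Tu⊆S S⊆ →
      h≡0 S (Tu⊆S ∘ p⊆p∪q ⁅ u ⁆) (move-u-into-L ∘ S⊆)

subsetSum-map-suc : ∀ {n} (h : Subset (suc n) → ℤ) b L T →
                    subsetSum h (map suc L) (b ∷ T) ≡ subsetSum (h ∘ (b ∷_)) L T
subsetSum-map-suc h b []      T = refl
subsetSum-map-suc h b (u ∷ L) T = cong₂ _+_ (subsetSum-map-suc h b L T) (begin
  subsetSum h (map suc L) ((b ∷ T) ∪ ⁅ suc u ⁆)
    ≡⟨ cong (λ c → subsetSum h (map suc L) (c ∷ T ∪ ⁅ u ⁆)) (∨-identityʳ b) ⟩
  subsetSum h (map suc L) (b ∷ T ∪ ⁅ u ⁆)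
    ≡⟨ subsetSum-map-suc h b L (T ∪ ⁅ u ⁆) ⟩
  subsetSum (h ∘ (b ∷_)) L (T ∪ ⁅ u ⁆) ∎)

sum-allSubsets : ∀ n (h : Subset n → ℤ) → sumℤ (map h (allSubsets n)) ≡ subsetSum h (allFin n) ∅
sum-allSubsets 0       h = ℤ.+-identityʳ (h [])
sum-allSubsets (suc n) h = begin
  sumℤ (map h (map (inside ∷_) A ++ map (outside ∷_) A))
    ≡⟨ cong sumℤ (map-++ h (map (inside ∷_) A) _) ⟩
  sumℤ (map h (map (inside ∷_) A) ++ map h (map (outside ∷_) A))
    ≡⟨ sumℤ-++ (map h (map (inside ∷_) A)) _ ⟩
  sumℤ (map h (map (inside ∷_) A)) + sumℤ (map h (map (outside ∷_) A))
    ≡⟨ cong₂ _+_ (half inside) (half outside) ⟩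
  Σ inside ∅ + Σ outside ∅
    ≡⟨ ℤ.+-comm (Σ inside ∅) _ ⟩
  Σ outside ∅ + Σ inside ∅
    ≡⟨ cong (Σ outside ∅ +_) (cong (Σ inside) (sym (∪-identityʳ ∅))) ⟩
  Σ outside ∅ + Σ inside (∅ ∪ ∅)
    ≡⟨ sym (cong₂ _+_ (subsetSum-map-suc h outside (allFin n) ∅)
                      (subsetSum-map-suc h inside (allFin n) (∅ ∪ ∅))) ⟩
  subsetSum h (zero ∷ map suc (allFin n)) ∅
    ≡⟨ cong (λ L → subsetSum h (zero ∷ L) ∅) (map-tabulate (λ i → i) suc) ⟩
  subsetSum h (allFin (suc n)) ∅ ∎
  where
  A : List (Subset n)
  A = allSubsets n
  Σ : Bool → Subset n → ℤ
  Σ b = subsetSum (h ∘ (b ∷_)) (allFin n)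
  half : ∀ b → sumℤ (map h (map (b ∷_) A)) ≡ Σ b ∅
  half b = ≡-trans (cong sumℤ (sym (map-∘ A))) (sum-allSubsets n (h ∘ (b ∷_)))

∣p∪⁅x⁆∣≡1+∣p∣ : ∀ {n} (p : Subset n) x → x ∉ₛ p → ∣ p ∪ ⁅ x ⁆ ∣ ≡ suc ∣ p ∣
∣p∪⁅x⁆∣≡1+∣p∣ (inside  ∷ p) zero    x∉p = ⊥-elim (x∉p here)
∣p∪⁅x⁆∣≡1+∣p∣ (outside ∷ p) zero    _   = cong (suc ∘ ∣_∣) (∪-identityʳ p)
∣p∪⁅x⁆∣≡1+∣p∣ (inside  ∷ p) (suc x) x∉p = cong suc (∣p∪⁅x⁆∣≡1+∣p∣ p x (x∉p ∘ there))
∣p∪⁅x⁆∣≡1+∣p∣ (outside ∷ p) (suc x) x∉p = ∣p∪⁅x⁆∣≡1+∣p∣ p x (x∉p ∘ there)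

module _ {n} (Γ : Multigraph n) where

  IsPath-prefix : ∀ {x y z} pre mid → IsPath Γ x (pre ++ z ∷ mid) y → IsPath Γ x pre z
  IsPath-prefix {x} {y} {z} pre mid (unique , linked) =
    AllPairs-++⁻ˡ (x ∷ pre ++ [ z ]) (subst Unique regroup unique) ,
    Linked-++⁻ˡ (x ∷ pre ++ [ z ]) (subst (Linked (Adj Γ)) regroup linked)
    where
    regroup : x ∷ (pre ++ z ∷ mid) ++ [ y ] ≡ (x ∷ pre ++ [ z ]) ++ mid ++ [ y ]
    regroup = cong (x ∷_) (≡-trans (++-assoc pre (z ∷ mid) [ y ]) (sym (++-assoc pre [ z ] (mid ++ [ y ]))))

module _ {n} (Γ : Multigraph n) (v : Fin n) where

  VertexInfects-mono : ∀ {T T′ w} → T ⊆ T′ → VertexInfects Γ v T w → VertexInfects Γ v T′ w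
  VertexInfects-mono T⊆T′ (mid , path , mid⊆T) = mid , path , All.map T⊆T′ mid⊆T

  -- The first vertex of L on a path from v to a vertex of L is infected by T.
  VertexInfects-entry : ∀ {T S L x} → (∀ {z} → z ∈ₛ S → z ∈ₛ T ⊎ z ∈ L) → x ∈ L →
                        VertexInfects Γ v S x → Any (VertexInfects Γ v T) L
  VertexInfects-entry {T} {S} {L} {x} S⊆T∪L x∈L (mid , path , mid⊆S) =
    walk [] mid path [] (All.map S⊆T∪L mid⊆S)
    where
    walk : ∀ pre mid → IsPath Γ v (pre ++ mid) x → All (_∈ₛ T) pre →
           All (λ z → z ∈ₛ T ⊎ z ∈ L) mid → Any (VertexInfects Γ v T) L
    walk pre []        path pre⊆T _ =
      lose x∈L (pre , subst (λ m → IsPath Γ v m x) (++-identityʳ pre) path , pre⊆T)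
    walk pre (z ∷ mid) path pre⊆T (inj₁ z∈T ∷ mid⊆T∪L) =
      walk (pre ++ [ z ]) mid (subst (λ m → IsPath Γ v m x) (sym (++-assoc pre [ z ] mid)) path)
           (++⁺ pre⊆T (z∈T ∷ [])) mid⊆T∪L
    walk pre (z ∷ mid) path pre⊆T (inj₂ z∈L ∷ _) =
      lose z∈L (pre , IsPath-prefix Γ pre mid path , pre⊆T)

  -- T is the part of F fixed so far and L lists the vertices not yet decided.
  record Stage (L : List (Fin n)) (T : Subset n) : Set where
    field
      unique   : Unique L
      v∉L      : v ∉ L
      disjoint : ∀ {z} → z ∈ L → z ∉ₛ T
      v∉T      : v ∉ₛ T
      infected : ∀ w → w ≢ v → w ∉ L → VertexInfects Γ v T w

  Stage-resp-↭ : ∀ {L L′ T} → L ↭ L′ → Stage L T → Stage L′ T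
  Stage-resp-↭ L↭L′ st = record
    { unique   = Unique-resp-↭ L↭L′ unique
    ; v∉L      = v∉L ∘ ∈-resp-↭ (↭-sym L↭L′)
    ; disjoint = disjoint ∘ ∈-resp-↭ (↭-sym L↭L′)
    ; v∉T      = v∉T
    ; infected = λ w w≢v w∉L′ → infected w w≢v (w∉L′ ∘ ∈-resp-↭ L↭L′)
    }
    where open Stage st

  Stage-without : ∀ {u L T} → Stage (u ∷ L) T → VertexInfects Γ v T u → Stage L T
  Stage-without {u} {L} {T} st T↝u = record
    { unique   = proj₂ (Unique-∷⁻ unique)
    ; v∉L      = v∉L ∘ there
    ; disjoint = disjoint ∘ there
    ; v∉T      = v∉T
    ; infected = infected′
    }
    where
    open Stage st
    infected′ : ∀ w → w ≢ v → w ∉ L → VertexInfects Γ v T w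
    infected′ w w≢v w∉L with w ≟ u
    ... | yes refl = T↝u
    ... | no  w≢u  = infected w w≢v λ { (here w≡u) → w≢u w≡u ; (there w∈L) → w∉L w∈L }

  Stage-with : ∀ {u L T} → Stage (u ∷ L) T → VertexInfects Γ v T u → Stage L (T ∪ ⁅ u ⁆)
  Stage-with {u} {L} {T} st T↝u = record
    { unique   = Stage.unique rest
    ; v∉L      = Stage.v∉L rest
    ; disjoint = disjoint′
    ; v∉T      = v∉T′
    ; infected = λ w w≢v w∉L → VertexInfects-mono (p⊆p∪q ⁅ u ⁆) (Stage.infected rest w w≢v w∉L)
    }
    where
    open Stage st
    rest : Stage L T
    rest = Stage-without st T↝u
    u∉L : u ∉ L
    u∉L = proj₁ (Unique-∷⁻ unique)
    disjoint′ : ∀ {z} → z ∈ L → z ∉ₛ T ∪ ⁅ u ⁆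
    disjoint′ z∈L z∈T∪⁅u⁆ with x∈p∪q⁻ T ⁅ u ⁆ z∈T∪⁅u⁆
    ... | inj₁ z∈T   = disjoint (there z∈L) z∈T
    ... | inj₂ z∈⁅u⁆ = u∉L (subst (_∈ L) (x∈⁅y⁆⇒x≡y u z∈⁅u⁆) z∈L)
    v∉T′ : v ∉ₛ T ∪ ⁅ u ⁆
    v∉T′ v∈T∪⁅u⁆ with x∈p∪q⁻ T ⁅ u ⁆ v∈T∪⁅u⁆
    ... | inj₁ v∈T   = v∉T v∈T
    ... | inj₂ v∈⁅u⁆ = v∉L (here (x∈⁅y⁆⇒x≡y u v∈⁅u⁆))

  Stage-[]-pandemic : ∀ {T} → Stage [] T → PandemicSubset Γ v T
  Stage-[]-pandemic st = v∉T , λ w w≢v → infected w w≢v λ ()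
    where open Stage st

  Stage-initial : ∀ {R} → allFin n ↭ v ∷ R → Stage R ∅
  Stage-initial {R} allFin↭v∷R = record
    { unique   = proj₂ v∷R-unique
    ; v∉L      = proj₁ v∷R-unique
    ; disjoint = λ _ → ∉⊥
    ; v∉T      = ∉⊥
    ; infected = λ w w≢v w∉R → ⊥-elim (w∉R (∈-allFin∖v allFin↭v∷R w≢v))
    }
    where
    v∷R-unique : v ∉ R × Unique R
    v∷R-unique = Unique-∷⁻ (Unique-resp-↭ allFin↭v∷R (allFin⁺ n))

module _ {n} (Γ : Multigraph n) (v : Fin n) (dec : Decidable (PandemicSubset Γ v)) where

  signIfPandemic : Subset n → ℤ
  signIfPandemic = restrict dec sign

  pandemic-pair-cancels : ∀ {T u} → u ∉ₛ T → PandemicSubset Γ v T → PandemicSubset Γ v (T ∪ ⁅ u ⁆) →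
                          signIfPandemic T + signIfPandemic (T ∪ ⁅ u ⁆) ≡ 0ℤ
  pandemic-pair-cancels {T} {u} u∉T T-pandemic T∪⁅u⁆-pandemic = begin
    signIfPandemic T + signIfPandemic (T ∪ ⁅ u ⁆)
      ≡⟨ cong₂ _+_ (restrict-accept dec sign T-pandemic) (restrict-accept dec sign T∪⁅u⁆-pandemic) ⟩
    sign T + -1ℤ ^ ∣ T ∪ ⁅ u ⁆ ∣  ≡⟨ cong (λ k → sign T + -1ℤ ^ k) (∣p∪⁅x⁆∣≡1+∣p∣ T u u∉T) ⟩
    sign T + -1ℤ * sign T         ≡⟨ cong (sign T +_) (ℤ.-1*i≡-i (sign T)) ⟩
    sign T + - sign T             ≡⟨ ℤ.+-inverseʳ (sign T) ⟩
    0ℤ                            ∎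

  sum-containing-v : ∀ L {T} → v ∈ₛ T → subsetSum signIfPandemic L T ≡ 0ℤ
  sum-containing-v L {T} v∈T = subsetSum-vanishing signIfPandemic L T λ S T⊆S _ →
    restrict-reject dec sign λ (v∉S , _) → v∉S (T⊆S v∈T)

  sum-uninfected : ∀ {L T x} → Stage Γ v L T → x ∈ L → ¬ Any (VertexInfects Γ v T) L →
                   subsetSum signIfPandemic L T ≡ 0ℤ
  sum-uninfected {L} {T} {x} st x∈L uninfected = subsetSum-vanishing signIfPandemic L T λ S _ S⊆T∪L →
    restrict-reject dec sign λ (_ , pandemic) →
      uninfected (VertexInfects-entry Γ v S⊆T∪L x∈L (pandemic x (Stage.v∉L st ∘ x≡v⇒v∈L)))
    where
    x≡v⇒v∈L : x ≡ v → v ∈ L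
    x≡v⇒v∈L refl = x∈L

  mutual
    -- Whether T infects a vertex of L is not decidable here, but the goal is
    -- a decidable equation, so the case split may be made under ¬¬.
    sum-stage : ∀ k {x L T} → length L ≡ k → Stage Γ v (x ∷ L) T →
                subsetSum signIfPandemic (x ∷ L) T ≡ 0ℤ
    sum-stage k {x} {L} {T} |L| st =
      decidable-stable (subsetSum signIfPandemic (x ∷ L) T ℤ.≟ 0ℤ) λ sum≢0 →
        ¬¬-excluded-middle (sum≢0 ∘ byInfection)
      where
      byInfection : Dec (Any (VertexInfects Γ v T) (x ∷ L)) → subsetSum signIfPandemic (x ∷ L) T ≡ 0ℤ
      byInfection (no uninfected) = sum-uninfected st (here refl) uninfected
      byInfection (yes infected) with find infected
      ... | u , u∈x∷L , T↝u with ∈⇒↭ u∈x∷L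
      ... | R , x∷L↭u∷R = ≡-trans (subsetSum-resp-↭ signIfPandemic x∷L↭u∷R T)
        (sum-split k (ℕ.suc-injective (≡-trans (sym (↭-length x∷L↭u∷R)) (cong suc |L|)))
                   (Stage-resp-↭ Γ v x∷L↭u∷R st) T↝u)

    sum-split : ∀ k {u R T} → length R ≡ k → Stage Γ v (u ∷ R) T → VertexInfects Γ v T u →
                subsetSum signIfPandemic (u ∷ R) T ≡ 0ℤ
    sum-split 0 {R = []} _ st T↝u =
      pandemic-pair-cancels (Stage.disjoint st (here refl))
        (Stage-[]-pandemic Γ v (Stage-without Γ v st T↝u)) (Stage-[]-pandemic Γ v (Stage-with Γ v st T↝u))
    sum-split (suc k) {R = r ∷ R} |R| st T↝u =
      cong₂ _+_ (sum-stage k (ℕ.suc-injective |R|) (Stage-without Γ v st T↝u))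
                (sum-stage k (ℕ.suc-injective |R|) (Stage-with Γ v st T↝u))

  sum-stage-nonempty : ∀ {x L T} → Stage Γ v L T → x ∈ L → subsetSum signIfPandemic L T ≡ 0ℤ
  sum-stage-nonempty {L = _ ∷ L} st _ = sum-stage (length L) refl st

theorem3p2 : ∀ {n} (Γ : Multigraph n) (v : Fin n) →
               (∃ λ w → w ≢ v) →
               (dec : Decidable (PandemicSubset Γ v)) →
               pandemicSignSum Γ v dec ≡ 0ℤ
theorem3p2 {n} Γ v (w , w≢v) dec with ∈⇒↭ (∈-allFin v)
... | R , allFin↭v∷R = begin
  pandemicSignSum Γ v dec                          ≡⟨ sumℤ-filter dec sign (allSubsets n) ⟩
  sumℤ (map g (allSubsets n))                      ≡⟨ sum-allSubsets n g ⟩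
  subsetSum g (allFin n) ∅                         ≡⟨ subsetSum-resp-↭ g allFin↭v∷R ∅ ⟩
  subsetSum g R ∅ + subsetSum g R (∅ ∪ ⁅ v ⁆)      ≡⟨ cong₂ _+_ R-sum v-sum ⟩
  0ℤ                                               ∎
  where
  g : Subset n → ℤ
  g = signIfPandemic Γ v dec
  R-sum : subsetSum g R ∅ ≡ 0ℤ
  R-sum = sum-stage-nonempty Γ v dec (Stage-initial Γ v allFin↭v∷R) (∈-allFin∖v allFin↭v∷R w≢v)
  v-sum : subsetSum g R (∅ ∪ ⁅ v ⁆) ≡ 0ℤ
  v-sum = sum-containing-v Γ v dec R (x∈p∪q⁺ (inj₂ (x∈⁅x⁆ v)))
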